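{- Let $k,l\in\mathbb{N}$ and let $G$ be a multigraph whose underlying graph is the cycle $C_{2k+2}$ with vertices $v_1,\dots,v_{2k+2}$ in cyclic order, such that $e_G(v_i,v_{i+1})=1$ for each $i\in[2k+1]$ and $e_G(v_1,v_{2k+2})=l$. Then $P_{DP}(G,m)=(m-1)^{2k+1}(m-l)-l$ whenever $m\ge l+1$.
   Context: All graphs are finite, loopless multigraphs; the underlying graph of $G$ is the simple graph obtained by removing parallel edges. For $u,v\in V(G)$, $E_G(u,v)$ is the set of edges joining $u,v$ and $e_G(u,v)=|E_G(u,v)|$. A cover of $G$ is a triple $\mathcal{H}=(L,H,M)$: $L$ assigns to each vertex a nonempty finite set, $H$ is a multigraph on $\bigcup_x L(x)$, $M$ assigns to each edge $e$ (with endpoints $u,v$) a matching $M(e)$ of $H$ whose edges go between $L(u)$ and $L(v)$, such that the $L(x)$ are pairwise disjoint, each $H[L(x)]$ is complete, $M(e_1)\cap M(e_2)=\emptyset$ for distinct edges, and for distinct $u,v$ the edges of $H$ between $L(u)$ and $L(v)$ are exactly $\bigcup_{e\in E_G(u,v)}M(e)$. It is a full $m$-fold cover if $|L(x)|=m$ for all $x$ and there are exactly $e_G(u,v)m$ edges of $H$ between $L(u)$ and $L(v)$ for all distinct $u,v$. An $\mathcal{H}$-coloring is an independent set of $H$ of size $|V(G)|$; $P_{DP}(G,\mathcal{H})$ is their number; $P_{DP}(G,m)$ is the minimum of $P_{DP}(G,\mathcal{H})$ over all full $m$-fold covers $\mathcal{H}$ of $G$. -}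

module Defs where

open import Data.Nat using (ℕ; zero; suc; _+_; _*_; _≤_)
open import Data.Nat.ListAction using (sum)
open import Data.Bool.ListAction using (and)
open import Data.Bool using (Bool; true; false; if_then_else_; not)
open import Data.Fin using (Fin; zero; suc; inject₁; fromℕ; toℕ; _≟_)
open import Data.Fin.Properties using (toℕ-inject₁)
open import Data.List using (List; []; _∷_; length; lookup; map; allFin; replicate; _++_)
open import Data.List.Relation.Unary.All using (All; []; _∷_)
open import Data.Product using (Σ; _×_; _,_; proj₁; proj₂)
open import Data.Vec.Functional as VF using ()
open import Function.Bundles using (_⤖_; Bijection)
open import Relation.Nullary using (¬_)
open import Relation.Nullary.Decidable using (⌊_⌋)
open import Relation.Binary.PropositionalEquality using (_≡_; _≢_; cong; trans; sym)

-- Vertices are Fin n; edges are an explicit list of (ordered) endpoint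
-- pairs, the identity of an edge being its position in the list, so
-- parallel edges are repeated entries.  E_G(u,v) = the positions whose
-- endpoints are {u,v}.

record Multigraph : Set where
  field
    n        : ℕ
    edges    : List (Fin n × Fin n)
    loopless : All (λ p → proj₁ p ≢ proj₂ p) edges

  Edge : Set
  Edge = Fin (length edges)

  tail : Edge → Fin n
  tail e = proj₁ (lookup edges e)

  head : Edge → Fin n
  head e = proj₂ (lookup edges e)

open Multigraph public

-- Up to isomorphism we take L(x) = {x} × Fin m.  In a full m-fold cover
-- every matching M(e) (e with endpoints u = tail e, v = head e) has exactly
-- m edges (the M(e), e ∈ E_G(u,v), are pairwise disjoint, each has at most
-- m edges, and together they have e_G(u,v)·m edges), i.e. M(e) is a perfect
-- matching between L(u) and L(v), which is given by a bijection
-- σ_e : Fin m ⤖ Fin m:  M(e) = { (u,i)(v,σ_e i) : i ∈ Fin m }.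
-- H is then determined: the cliques on the L(x) plus all M(e).

FullCover : Multigraph → ℕ → Set
FullCover G m = Edge G → Fin m ⤖ Fin m

-- An independent set of H of size |V(G)| contains exactly one vertex of
-- each clique L(x), so it is a choice function c : V(G) → Fin m (c x
-- being the chosen element of L(x) = {x} × Fin m) such that no edge of any
-- M(e) joins two chosen vertices.

isHColoring : (G : Multigraph) (m : ℕ) → FullCover G m → (Fin (n G) → Fin m) → Bool
isHColoring G m σ c =
  and (map (λ e → not ⌊ Bijection.to (σ e) (c (tail G e)) ≟ c (head G e) ⌋) (allFin (length (edges G))))

countFuns : (n m : ℕ) → ((Fin n → Fin m) → Bool) → ℕ
countFuns zero    m P = if P (λ ()) then 1 else 0
countFuns (suc n) m P = sum (map (λ i → countFuns n m (λ f → P (i VF.∷ f))) (allFin m))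

P-DP-cover : (G : Multigraph) (m : ℕ) → FullCover G m → ℕ
P-DP-cover G m σ = countFuns (n G) m (isHColoring G m σ)

P-DP-is : Multigraph → ℕ → ℕ → Set
P-DP-is G m p =
  (Σ (FullCover G m) λ σ → P-DP-cover G m σ ≡ p) × ((σ : FullCover G m) → p ≤ P-DP-cover G m σ)

-- The multigraph of Proposition 15: underlying graph C_{2k+2} on
-- v_1,…,v_{2k+2} (here v_{i} = vertex i-1 of Fin (2k+2)), one edge
-- v_i v_{i+1} for i ∈ [2k+1] and l parallel edges v_1 v_{2k+2}.

private
  all-map : {A B : Set} {P : B → Set} (f : A → B) → (∀ x → P (f x)) → (xs : List A) → All P (map f xs)
  all-map f h []       = []
  all-map f h (x ∷ xs) = h x ∷ all-map f h xs

  all-rep : {B : Set} {P : B → Set} (b : B) → P b → (l : ℕ) → All P (replicate l b)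
  all-rep b p zero    = []
  all-rep b p (suc l) = p ∷ all-rep b p l

  all-++ : {B : Set} {P : B → Set} {xs ys : List B} → All P xs → All P ys → All P (xs ++ ys)
  all-++ []       q = q
  all-++ (p ∷ ps) q = p ∷ all-++ ps q

  n≢1+n : ∀ (x : ℕ) → x ≢ suc x
  n≢1+n zero ()
  n≢1+n (suc x) eq = n≢1+n x (cong pred' eq)
    where pred' : ℕ → ℕ
          pred' zero = zero
          pred' (suc y) = y

  inj≢suc : ∀ {p} (i : Fin p) → inject₁ i ≢ suc i
  inj≢suc i eq = n≢1+n (toℕ i) (trans (sym (toℕ-inject₁ i)) (cong toℕ eq))

  z≢s : ∀ {p} {j : Fin p} → zero ≢ suc j
  z≢s ()

cycleEdges : (k l : ℕ) → List (Fin (suc (suc (2 * k))) × Fin (suc (suc (2 * k))))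
cycleEdges k l =
  map (λ i → inject₁ i , suc i) (allFin (suc (2 * k)))
  ++ replicate l (zero , fromℕ (suc (2 * k)))

cycleMultigraph : (k l : ℕ) → Multigraph
cycleMultigraph k l = record
  { n        = suc (suc (2 * k))
  ; edges    = cycleEdges k l
  ; loopless = all-++ (all-map _ (λ i → inj≢suc i) (allFin (suc (2 * k))))
                      (all-rep _ z≢s l)
  }

module Submission where

-- Fix the colour a of v₁.  The colours of v₂, …, v_{2k+2} continue a to a colouring of the path
-- v₁ v₂ … v_{2k+2} along the matchings τ₁, …, τ_p (p = 2k + 1), whose last colour must moreover
-- avoid the l colours ρ₁(a), …, ρ_l(a) matched to a by the parallel edges.  Of the (m − 1)^p
-- colourings of the path, D_p end in the colour τ_p ⋯ τ₁(a) and O_p in each other colour, where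
-- D_p + (m − 1) O_p = (m − 1)^p and, p being odd, O_p = D_p + 1.  So at most l O_p of them are
-- lost, and summing over a leaves at least m ((m − 1)^p − l O_p) = (m − 1)^p (m − l) − l
-- colourings.  Equality holds when every τ_i is the identity and ρ_j is the rotation by j of
-- ℤ/m: then the ρ_j(a) are l distinct colours, all different from τ_p ⋯ τ₁(a) = a.

open import Defs
open import Data.Nat.Properties as ℕ
  using ( +-0-commutativeMonoid; +-commutativeSemigroup; +-comm; +-assoc; +-identityʳ; *-comm; *-assoc
        ; *-zeroʳ; *-identityʳ; *-suc; *-distribˡ-+; *-distribʳ-+; +-cancelˡ-≡; +-cancelˡ-≤; +-mono-≤
        ; +-monoʳ-≤; ≤-refl; ≤-reflexive; ≤-trans; ≤-<-trans; <⇒≤; n≤1+n; 1+n≢0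
        ; m+[n∸m]≡n; m∸n+n≡m; m+n∸m≡n; m≤n+o⇒m∸n≤o; module ≤-Reasoning)
open import Algebra.Properties.CommutativeMonoid.Sum +-0-commutativeMonoid
  using (sum; sum-syntax; sum-cong-≗; sum-remove; ∑-distrib-+; ∑-comm)
open import Algebra.Properties.CommutativeSemigroup +-commutativeSemigroup using (x∙yz≈y∙xz)
open import Data.Bool using (Bool; true; false; if_then_else_; not; _∧_)
open import Data.Bool.ListAction using (and)
open import Data.Bool.Properties using (∧-assoc)
open import Data.Fin using (Fin; zero; suc; toℕ; fromℕ; inject₁; punchIn; cast; _≟_)
open import Data.Fin.Properties
  using (0≢1+n; punchInᵢ≢i; suc-injective; toℕ-fromℕ<; toℕ-injective; toℕ<n; toℕ-cast; cast-is-id)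
open import Data.List using (List; []; _∷_; _++_; length; lookup; map; tabulate; allFin; replicate)
open import Data.List.Properties
  using (map-tabulate; tabulate-cong; length-map; length-tabulate; length-replicate; lookup-replicate)
open import Data.Nat using (ℕ; zero; suc; pred; _+_; _*_; _∸_; _^_; _≤_; _<_; z≤n; s≤s; NonZero; >-nonZero⁻¹)
import Data.Nat.ListAction as ListAction
open import Data.Nat.DivMod using (_%_; _mod_; m%n<n; %-distribˡ-+; m%n%n≡m%n; [m+n]%n≡m%n; m<n⇒m%n≡m)
open import Data.Nat.Tactic.RingSolver using (solve-∀)
open import Data.Product using (_×_; _,_; proj₁; proj₂)
open import Data.Sum as Sum using (_⊎_; inj₁; inj₂; [_,_]′)
open import Data.Vec.Functional as Vector using (removeAt)
open import Function using (_∘_; id)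
open import Function.Bundles using (_⤖_; Bijection; mk↔ₛ′)
open import Function.Construct.Composition using (_⤖-∘_)
open import Function.Construct.Identity using (⤖-id)
open import Function.Definitions using (Injective)
open import Function.Properties.Inverse using (↔⇒⤖)
open import Relation.Binary.PropositionalEquality
open import Relation.Nullary using (yes; no; contradiction)
open import Relation.Nullary.Decidable using (⌊_⌋)

open Bijection using (to; injective; strictlySurjective)

𝟙 : Bool → ℕ
𝟙 b = if b then 1 else 0

override : ∀ {m} → Fin m → ℕ → (Fin m → ℕ) → Fin m → ℕ
override u d h y = if ⌊ u ≟ y ⌋ then d else h y

spike : ∀ {m} → Fin m → ℕ → ℕ → Fin m → ℕ
spike u d o = override u d (λ _ → o)

δ : ∀ {m} → Fin m → Fin m → ℕ
δ v = spike v 1 0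

override-self : ∀ {m} (u : Fin m) d h → override u d h u ≡ d
override-self u d h with u ≟ u
... | yes _   = refl
... | no u≢u = contradiction refl u≢u

override-other : ∀ {m} {u y : Fin m} d h → u ≢ y → override u d h y ≡ h y
override-other {u = u} {y} d h u≢y with u ≟ y
... | yes u≡y = contradiction u≡y u≢y
... | no _    = refl

spike-≤ : ∀ {m} (u y : Fin m) {d o} → d ≤ o → spike u d o y ≤ o
spike-≤ u y d≤o with u ≟ y
... | yes _ = d≤o
... | no _  = ≤-refl

sum-const : ∀ n c → ∑[ i < n ] c ≡ n * c
sum-const zero    c = refl
sum-const (suc n) c = cong (c +_) (sum-const n c)

sum-+-const : ∀ {n} (f : Fin n → ℕ) c → ∑[ i < n ] (f i + c) ≡ sum f + n * c
sum-+-const {n} f c = trans (∑-distrib-+ f (λ _ → c)) (cong (sum f +_) (sum-const n c))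

sum-mono-≤ : ∀ {n} {f g : Fin n → ℕ} → (∀ i → f i ≤ g i) → sum f ≤ sum g
sum-mono-≤ {zero}  f≤g = z≤n
sum-mono-≤ {suc n} f≤g = +-mono-≤ (f≤g zero) (sum-mono-≤ (f≤g ∘ suc))

sum-override : ∀ {n} (u : Fin (suc n)) d h → sum (override u d h) ≡ d + sum (removeAt h u)
sum-override u d h = begin
  sum (override u d h)                                  ≡⟨ sum-remove {i = u} (override u d h) ⟩
  override u d h u + sum (removeAt (override u d h) u)  ≡⟨ cong₂ _+_ (override-self u d h) (sum-cong-≗ λ j →
                                                             override-other d h (punchInᵢ≢i u j ∘ sym)) ⟩
  d + sum (removeAt h u)                                ∎
  where open ≡-Reasoning

sum-spike : ∀ {n} (u : Fin (suc n)) d o → sum (spike u d o) ≡ d + n * o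
sum-spike {n} u d o = trans (sum-override u d (λ _ → o)) (cong (d +_) (sum-const n o))

sum-removeAt-spike : ∀ {r} (u w : Fin (2 + r)) d o →
  sum (removeAt (spike u d o) w) ≡ spike u (suc r * o) (d + r * o) w
sum-removeAt-spike {r} u w d o with u ≟ w
... | yes refl = begin
  sum (removeAt (spike u d o) u)  ≡⟨ sum-cong-≗ (λ j → override-other d (λ _ → o) (punchInᵢ≢i u j ∘ sym)) ⟩
  ∑[ j < suc r ] o                 ≡⟨ sum-const (suc r) o ⟩
  suc r * o                        ∎
  where open ≡-Reasoning
... | no u≢w = +-cancelˡ-≡ o _ _ (begin
  o + S              ≡⟨ cong (_+ S) (override-other d (λ _ → o) u≢w) ⟨
  spike u d o w + S  ≡⟨ sum-remove {i = w} (spike u d o) ⟨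
  sum (spike u d o)  ≡⟨ sum-spike u d o ⟩
  d + (o + r * o)    ≡⟨ x∙yz≈y∙xz d o (r * o) ⟩
  o + (d + r * o)    ∎)
  where
  open ≡-Reasoning
  S = sum (removeAt (spike u d o) w)

sum-tabulate : ∀ {n} (h : Fin n → ℕ) → ListAction.sum (tabulate h) ≡ sum h
sum-tabulate {zero}  h = refl
sum-tabulate {suc n} h = cong (h zero +_) (sum-tabulate (h ∘ suc))

countFuns-suc : ∀ n m P → countFuns (suc n) m P ≡ ∑[ i < m ] countFuns n m (λ f → P (i Vector.∷ f))
countFuns-suc n m P = trans (cong ListAction.sum (map-tabulate id h)) (sum-tabulate h)
  where
  h : Fin m → ℕ
  h i = countFuns n m (λ f → P (i Vector.∷ f))

countFuns-false : ∀ n m → countFuns n m (λ _ → false) ≡ 0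
countFuns-false zero    m = refl
countFuns-false (suc n) m = begin
  countFuns (suc n) m (λ _ → false)       ≡⟨ countFuns-suc n m (λ _ → false) ⟩
  ∑[ i < m ] countFuns n m (λ _ → false)  ≡⟨ sum-cong-≗ {m} (λ _ → countFuns-false n m) ⟩
  ∑[ i < m ] 0                            ≡⟨ sum-const m 0 ⟩
  m * 0                                   ≡⟨ *-zeroʳ m ⟩
  0                                       ∎
  where open ≡-Reasoning

countFuns-cong : ∀ n m {P Q} → P ≗ Q → countFuns n m P ≡ countFuns n m Q
countFuns-cong zero    m P≗Q = cong 𝟙 (P≗Q _)
countFuns-cong (suc n) m {P} {Q} P≗Q = begin
  countFuns (suc n) m P
    ≡⟨ countFuns-suc n m P ⟩
  ∑[ i < m ] countFuns n m (λ f → P (i Vector.∷ f))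
    ≡⟨ sum-cong-≗ (λ i → countFuns-cong n m (P≗Q ∘ (i Vector.∷_))) ⟩
  ∑[ i < m ] countFuns n m (λ f → Q (i Vector.∷ f))
    ≡⟨ countFuns-suc n m Q ⟨
  countFuns (suc n) m Q  ∎
  where open ≡-Reasoning

countFuns-guard : ∀ n m b P → countFuns n m (λ f → not b ∧ P f) ≡ (if b then 0 else countFuns n m P)
countFuns-guard n m true  P = countFuns-false n m
countFuns-guard n m false P = refl

-- Colourings of a path

module _ {m : ℕ} where

  avoids : ∀ {l} → (Fin l → Fin m) → Fin m → Bool
  avoids v z = and (tabulate λ j → not ⌊ v j ≟ z ⌋)

  hits : ∀ {l} → (Fin l → Fin m) → Fin m → ℕ
  hits {l} v z = ∑[ j < l ] δ (v j) z

  1≤avoids+hits : ∀ {l} (v : Fin l → Fin m) z → 1 ≤ 𝟙 (avoids v z) + hits v z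
  1≤avoids+hits {zero}  v z = ≤-refl
  1≤avoids+hits {suc l} v z with v zero ≟ z
  ... | yes _ = s≤s z≤n
  ... | no _  = 1≤avoids+hits (v ∘ suc) z

  avoids+hits≡1 : ∀ {l} (v : Fin l → Fin m) → Injective _≡_ _≡_ v → ∀ z → 𝟙 (avoids v z) + hits v z ≡ 1
  avoids+hits≡1 {zero}  v v-inj z = refl
  avoids+hits≡1 {suc l} v v-inj z with v zero ≟ z
  ... | yes refl = cong suc (begin
    ∑[ j < l ] δ (v (suc j)) (v zero)  ≡⟨ sum-cong-≗ {l} (λ j →
                                            override-other 1 _ (0≢1+n ∘ sym ∘ v-inj)) ⟩
    ∑[ j < l ] 0                       ≡⟨ sum-const l 0 ⟩
    l * 0                              ≡⟨ *-zeroʳ l ⟩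
    0                                  ∎)
    where open ≡-Reasoning
  ... | no _     = avoids+hits≡1 (v ∘ suc) (suc-injective ∘ v-inj) z

  isPathColoring : ∀ q → (Fin q → Fin m ⤖ Fin m) → Fin m → (Fin m → Bool) → (Fin q → Fin m) → Bool
  isPathColoring zero    τ x Q f = Q x
  isPathColoring (suc q) τ x Q f =
    not ⌊ to (τ zero) x ≟ f zero ⌋ ∧ isPathColoring q (τ ∘ suc) (f zero) Q (f ∘ suc)

  isPathColoring-tabulate : ∀ q (τ : Fin q → Fin m ⤖ Fin m) (c : Fin (suc q) → Fin m) Q →
    and (tabulate λ i → not ⌊ to (τ i) (c (inject₁ i)) ≟ c (suc i) ⌋) ∧ Q (c (fromℕ q))
      ≡ isPathColoring q τ (c zero) Q (c ∘ suc)
  isPathColoring-tabulate zero    τ c Q = refl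
  isPathColoring-tabulate (suc q) τ c Q =
    trans (∧-assoc first (and (tabulate rest)) (Q (c (fromℕ (suc q)))))
          (cong (first ∧_) (isPathColoring-tabulate q (τ ∘ suc) (c ∘ suc) Q))
    where
    first : Bool
    first = not ⌊ to (τ zero) (c zero) ≟ c (suc zero) ⌋
    rest : Fin q → Bool
    rest i = not ⌊ to (τ (suc i)) (c (suc (inject₁ i))) ≟ c (suc (suc i)) ⌋

  chain : ∀ q → (Fin q → Fin m ⤖ Fin m) → Fin m ⤖ Fin m
  chain zero    τ = ⤖-id (Fin m)
  chain (suc q) τ = chain q (τ ∘ suc) ⤖-∘ τ zero

  chain-id : ∀ q (τ : Fin q → Fin m ⤖ Fin m) → (∀ i y → to (τ i) y ≡ y) → ∀ x → to (chain q τ) x ≡ x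
  chain-id zero    τ τ≗id x = refl
  chain-id (suc q) τ τ≗id x = trans (chain-id q (τ ∘ suc) (τ≗id ∘ suc) (to (τ zero) x)) (τ≗id zero x)

  spike-∘ : ∀ (π : Fin m ⤖ Fin m) {u v} → to π u ≡ v → ∀ d o y → spike v d o (to π y) ≡ spike u d o y
  spike-∘ π {u} {v} πu≡v d o y with u ≟ y
  ... | yes refl = trans (cong (λ t → spike t d o (to π u)) (sym πu≡v)) (override-self (to π u) d (λ _ → o))
  ... | no u≢y   = override-other d _ (λ v≡πy → u≢y (injective π (trans πu≡v v≡πy)))

module _ {n : ℕ} where

  pathCount : ∀ q → (Fin q → Fin (suc n) ⤖ Fin (suc n)) → Fin (suc n) → (Fin (suc n) → ℕ) → ℕ
  pathCount zero    τ x w = w x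
  pathCount (suc q) τ x w = sum (removeAt (λ y → pathCount q (τ ∘ suc) y w) (to (τ zero) x))

  countFuns-isPathColoring : ∀ q τ x Q →
    countFuns q (suc n) (isPathColoring q τ x Q) ≡ pathCount q τ x (𝟙 ∘ Q)
  countFuns-isPathColoring zero    τ x Q = refl
  countFuns-isPathColoring (suc q) τ x Q = begin
    countFuns (suc q) (suc n) (isPathColoring (suc q) τ x Q)
      ≡⟨ countFuns-suc q (suc n) (isPathColoring (suc q) τ x Q) ⟩
    ∑[ y < suc n ] countFuns q (suc n) (λ f → not ⌊ w ≟ y ⌋ ∧ isPathColoring q (τ ∘ suc) y Q f)
      ≡⟨ sum-cong-≗ (λ y → countFuns-guard q (suc n) ⌊ w ≟ y ⌋ (isPathColoring q (τ ∘ suc) y Q)) ⟩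
    sum (override w 0 counts)
      ≡⟨ sum-override w 0 counts ⟩
    sum (removeAt counts w)
      ≡⟨ sum-cong-≗ (λ j → countFuns-isPathColoring q (τ ∘ suc) (punchIn w j) Q) ⟩
    pathCount (suc q) τ x (𝟙 ∘ Q)  ∎
    where
    open ≡-Reasoning
    w = to (τ zero) x
    counts : Fin (suc n) → ℕ
    counts y = countFuns q (suc n) (isPathColoring q (τ ∘ suc) y Q)

  pathCount-cong : ∀ q τ x {w w′} → w ≗ w′ → pathCount q τ x w ≡ pathCount q τ x w′
  pathCount-cong zero    τ x w≗w′ = w≗w′ x
  pathCount-cong (suc q) τ x w≗w′ =
    sum-cong-≗ λ j → pathCount-cong q (τ ∘ suc) (punchIn (to (τ zero) x) j) w≗w′

  pathCount-mono-≤ : ∀ q τ x {w w′} → (∀ z → w z ≤ w′ z) → pathCount q τ x w ≤ pathCount q τ x w′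
  pathCount-mono-≤ zero    τ x w≤w′ = w≤w′ x
  pathCount-mono-≤ (suc q) τ x w≤w′ =
    sum-mono-≤ λ j → pathCount-mono-≤ q (τ ∘ suc) (punchIn (to (τ zero) x) j) w≤w′

  pathCount-+ : ∀ q τ x w w′ →
    pathCount q τ x (λ z → w z + w′ z) ≡ pathCount q τ x w + pathCount q τ x w′
  pathCount-+ zero    τ x w w′ = refl
  pathCount-+ (suc q) τ x w w′ = trans (sum-cong-≗ λ j → pathCount-+ q (τ ∘ suc) (y j) w w′)
                                       (∑-distrib-+ (λ j → pathCount q (τ ∘ suc) (y j) w)
                                                    (λ j → pathCount q (τ ∘ suc) (y j) w′))
    where y = punchIn (to (τ zero) x)

  pathCount-∑ : ∀ q τ x {l} (w : Fin l → Fin (suc n) → ℕ) →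
    pathCount q τ x (λ z → ∑[ j < l ] w j z) ≡ ∑[ j < l ] pathCount q τ x (w j)
  pathCount-∑ zero    τ x w = refl
  pathCount-∑ (suc q) τ x w = trans (sum-cong-≗ λ i → pathCount-∑ q (τ ∘ suc) (y i) w)
                                    (∑-comm λ i j → pathCount q (τ ∘ suc) (y i) (w j))
    where y = punchIn (to (τ zero) x)

  pathCount-const : ∀ q τ x c → pathCount q τ x (λ _ → c) ≡ n ^ q * c
  pathCount-const zero    τ x c = sym (+-identityʳ c)
  pathCount-const (suc q) τ x c = begin
    ∑[ j < n ] pathCount q (τ ∘ suc) (punchIn (to (τ zero) x) j) (λ _ → c)
      ≡⟨ sum-cong-≗ (λ j → pathCount-const q (τ ∘ suc) (punchIn (to (τ zero) x) j) c) ⟩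
    ∑[ j < n ] (n ^ q * c)  ≡⟨ sum-const n _ ⟩
    n * (n ^ q * c)         ≡⟨ *-assoc n _ c ⟨
    n ^ suc q * c           ∎
    where open ≡-Reasoning

  pathCount-avoids+hits : ∀ q τ x {l} (v : Fin l → Fin (suc n)) →
    pathCount q τ x (λ z → 𝟙 (avoids v z) + hits v z)
      ≡ pathCount q τ x (𝟙 ∘ avoids v) + ∑[ j < l ] pathCount q τ x (δ (v j))
  pathCount-avoids+hits q τ x v = trans (pathCount-+ q τ x (𝟙 ∘ avoids v) (hits v))
    (cong (pathCount q τ x (𝟙 ∘ avoids v) +_) (pathCount-∑ q τ x (δ ∘ v)))

-- With m = 2 + r colours, the first step goes to one of the 1 + r colours y ≠ τ₁(x), and the
-- rest of the path ends in v through diag q or off q colourings according as v is the image of y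
-- or not; v is the image of exactly one such y unless it is the image of τ₁(x).

module _ (r : ℕ) where

  diag off : ℕ → ℕ
  diag zero    = 1
  diag (suc q) = suc r * off q
  off zero     = 0
  off (suc q)  = diag q + r * off q

  pathCount-δ : ∀ q (τ : Fin q → Fin (2 + r) ⤖ Fin (2 + r)) x v →
    pathCount q τ x (δ v) ≡ spike v (diag q) (off q) (to (chain q τ) x)
  pathCount-δ zero    τ x v = refl
  pathCount-δ (suc q) τ x v = begin
    ∑[ j < suc r ] pathCount q (τ ∘ suc) (punchIn w j) (δ v)
      ≡⟨ sum-cong-≗ {suc r} (λ j → trans (pathCount-δ q (τ ∘ suc) (punchIn w j) v)
                                          (spike-∘ π πu≡v _ _ (punchIn w j))) ⟩
    sum (removeAt (spike u (diag q) (off q)) w)  ≡⟨ sum-removeAt-spike u w _ _ ⟩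
    spike u (diag (suc q)) (off (suc q)) w       ≡⟨ spike-∘ π πu≡v _ _ w ⟨
    spike v (diag (suc q)) (off (suc q)) (to π w)  ∎
    where
    open ≡-Reasoning
    w = to (τ zero) x
    π = chain q (τ ∘ suc)
    u = proj₁ (strictlySurjective π v)
    πu≡v = proj₂ (strictlySurjective π v)

  diag+off : ∀ q → diag q + suc r * off q ≡ suc r ^ q
  diag+off zero    = cong suc (*-zeroʳ r)
  diag+off (suc q) = begin
    suc r * off q + suc r * (diag q + r * off q)  ≡⟨ *-distribˡ-+ (suc r) (off q) _ ⟨
    suc r * (off q + (diag q + r * off q))        ≡⟨ cong (suc r *_) (x∙yz≈y∙xz (off q) (diag q) _) ⟩
    suc r * (diag q + suc r * off q)              ≡⟨ cong (suc r *_) (diag+off q) ⟩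
    suc r * suc r ^ q                             ∎
    where open ≡-Reasoning

  diag-even : ∀ k → diag (2 * k) ≡ suc (off (2 * k))
  off-odd   : ∀ k → off (suc (2 * k)) ≡ suc (diag (suc (2 * k)))
  diag-even zero    = refl
  diag-even (suc k) = subst (λ q → diag q ≡ suc (off q)) (sym (*-suc 2 k))
    (cong (_+ r * off (suc (2 * k))) (off-odd k))
  off-odd k = cong (_+ r * off (2 * k)) (diag-even k)

module _ (r k : ℕ) where

  private
    p : ℕ
    p = suc (2 * k)

  [2+r]*off≡1+[1+r]^p : (2 + r) * off r p ≡ suc (suc r ^ p)
  [2+r]*off≡1+[1+r]^p = trans (cong (_+ suc r * off r p) (off-odd r k)) (cong suc (diag+off r p))

  pathCount-δ-≤ : ∀ (τ : Fin p → Fin (2 + r) ⤖ Fin (2 + r)) x v → pathCount p τ x (δ v) ≤ off r p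
  pathCount-δ-≤ τ x v = ≤-trans (≤-reflexive (pathCount-δ r p τ x v))
    (spike-≤ v _ (≤-trans (n≤1+n _) (≤-reflexive (sym (off-odd r k)))))

  pathCount-avoids-≥ : ∀ (τ : Fin p → Fin (2 + r) ⤖ Fin (2 + r)) a {l} (v : Fin l → Fin (2 + r)) →
    suc r ^ p ≤ pathCount p τ a (𝟙 ∘ avoids v) + l * off r p
  pathCount-avoids-≥ τ a {l} v = begin
    suc r ^ p                                          ≡⟨ *-identityʳ _ ⟨
    suc r ^ p * 1                                      ≡⟨ pathCount-const p τ a 1 ⟨
    pathCount p τ a (λ _ → 1)                          ≤⟨ pathCount-mono-≤ p τ a (1≤avoids+hits v) ⟩
    pathCount p τ a (λ z → 𝟙 (avoids v z) + hits v z)  ≡⟨ pathCount-avoids+hits p τ a v ⟩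
    A + ∑[ j < l ] pathCount p τ a (δ (v j))           ≤⟨ +-monoʳ-≤ A (sum-mono-≤ {l} λ j →
                                                            pathCount-δ-≤ τ a (v j)) ⟩
    A + ∑[ j < l ] off r p                             ≡⟨ cong (A +_) (sum-const l (off r p)) ⟩
    A + l * off r p                                    ∎
    where
    open ℕ.≤-Reasoning
    A : ℕ
    A = pathCount p τ a (𝟙 ∘ avoids v)

  pathCount-avoids-≡ : ∀ (τ : Fin p → Fin (2 + r) ⤖ Fin (2 + r)) a {l} (v : Fin l → Fin (2 + r)) →
    Injective _≡_ _≡_ v → (∀ j → v j ≢ to (chain p τ) a) →
    pathCount p τ a (𝟙 ∘ avoids v) + l * off r p ≡ suc r ^ p
  pathCount-avoids-≡ τ a {l} v v-inj v≢end = begin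
    A + l * off r p                                    ≡⟨ cong (A +_) (sum-const l (off r p)) ⟨
    A + ∑[ j < l ] off r p                             ≡⟨ cong (A +_) (sum-cong-≗ {l} λ j →
                                                            trans (pathCount-δ r p τ a (v j))
                                                                  (override-other _ (λ _ → off r p) (v≢end j))) ⟨
    A + ∑[ j < l ] pathCount p τ a (δ (v j))           ≡⟨ pathCount-avoids+hits p τ a v ⟨
    pathCount p τ a (λ z → 𝟙 (avoids v z) + hits v z)  ≡⟨ pathCount-cong p τ a (avoids+hits≡1 v v-inj) ⟩
    pathCount p τ a (λ _ → 1)                          ≡⟨ pathCount-const p τ a 1 ⟩
    suc r ^ p * 1                                      ≡⟨ *-identityʳ _ ⟩
    suc r ^ p                                          ∎
    where
    open ≡-Reasoning
    A : ℕ
    A = pathCount p τ a (𝟙 ∘ avoids v)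

-- Rotations of Fin m

module _ {m : ℕ} .{{_ : NonZero m}} where

  rotate : ℕ → Fin m → Fin m
  rotate d x = (toℕ x + d) mod m

  toℕ-rotate : ∀ d x → toℕ (rotate d x) ≡ (toℕ x + d) % m
  toℕ-rotate d x = toℕ-fromℕ< (m%n<n (toℕ x + d) m)

  rotate-+ : ∀ d e x → rotate e (rotate d x) ≡ rotate (d + e) x
  rotate-+ d e x = toℕ-injective (begin
    toℕ (rotate e (rotate d x))  ≡⟨ toℕ-rotate e (rotate d x) ⟩
    (toℕ (rotate d x) + e) % m   ≡⟨ cong (λ t → (t + e) % m) (toℕ-rotate d x) ⟩
    (s % m + e) % m              ≡⟨ %-distribˡ-+ (s % m) e m ⟩
    (s % m % m + e % m) % m      ≡⟨ cong (λ t → (t + e % m) % m) (m%n%n≡m%n s m) ⟩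
    (s % m + e % m) % m          ≡⟨ %-distribˡ-+ s e m ⟨
    (toℕ x + d + e) % m          ≡⟨ cong (_% m) (+-assoc (toℕ x) d e) ⟩
    (toℕ x + (d + e)) % m        ≡⟨ toℕ-rotate (d + e) x ⟨
    toℕ (rotate (d + e) x)       ∎)
    where
    open ≡-Reasoning
    s = toℕ x + d

  rotate-m : ∀ x → rotate m x ≡ x
  rotate-m x = toℕ-injective (begin
    toℕ (rotate m x)  ≡⟨ toℕ-rotate m x ⟩
    (toℕ x + m) % m   ≡⟨ [m+n]%n≡m%n (toℕ x) m ⟩
    toℕ x % m         ≡⟨ m<n⇒m%n≡m (toℕ<n x) ⟩
    toℕ x             ∎)
    where open ≡-Reasoning

  rotate-0 : ∀ x → rotate 0 x ≡ x
  rotate-0 x = toℕ-injective (begin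
    toℕ (rotate 0 x)  ≡⟨ toℕ-rotate 0 x ⟩
    (toℕ x + 0) % m   ≡⟨ cong (_% m) (+-identityʳ (toℕ x)) ⟩
    toℕ x % m         ≡⟨ m<n⇒m%n≡m (toℕ<n x) ⟩
    toℕ x             ∎)
    where open ≡-Reasoning

  rotation : ∀ d → d ≤ m → Fin m ⤖ Fin m
  rotation d d≤m = ↔⇒⤖ (mk↔ₛ′ (rotate d) (rotate (m ∸ d)) rotate-back rotate-forth)
    where
    rotate-back : ∀ y → rotate d (rotate (m ∸ d) y) ≡ y
    rotate-back y = trans (rotate-+ (m ∸ d) d y) (trans (cong (λ e → rotate e y) (m∸n+n≡m d≤m)) (rotate-m y))
    rotate-forth : ∀ x → rotate (m ∸ d) (rotate d x) ≡ x
    rotate-forth x = trans (rotate-+ d (m ∸ d) x) (trans (cong (λ e → rotate e x) (m+[n∸m]≡n d≤m)) (rotate-m x))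

  rotate-injectiveˡ : ∀ {d e} x → d < m → e < m → rotate d x ≡ rotate e x → d ≡ e
  rotate-injectiveˡ {d} {e} x d<m e<m eq = begin
    d                                  ≡⟨ rotate-undo d<m ⟨
    toℕ (rotate (m ∸ t) (rotate d x))  ≡⟨ cong (toℕ ∘ rotate (m ∸ t)) eq ⟩
    toℕ (rotate (m ∸ t) (rotate e x))  ≡⟨ rotate-undo e<m ⟩
    e                                  ∎
    where
    open ≡-Reasoning
    t = toℕ x
    rotate-undo : ∀ {c} → c < m → toℕ (rotate (m ∸ t) (rotate c x)) ≡ c
    rotate-undo {c} c<m = begin
      toℕ (rotate (m ∸ t) (rotate c x))  ≡⟨ cong toℕ (rotate-+ c (m ∸ t) x) ⟩
      toℕ (rotate (c + (m ∸ t)) x)       ≡⟨ toℕ-rotate (c + (m ∸ t)) x ⟩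
      (t + (c + (m ∸ t))) % m            ≡⟨ cong (_% m) (x∙yz≈y∙xz t c (m ∸ t)) ⟩
      (c + (t + (m ∸ t))) % m            ≡⟨ cong (λ s → (c + s) % m) (m+[n∸m]≡n (<⇒≤ (toℕ<n x))) ⟩
      (c + m) % m                        ≡⟨ [m+n]%n≡m%n c m ⟩
      c % m                              ≡⟨ m<n⇒m%n≡m c<m ⟩
      c                                  ∎

and-tabulate-cast : ∀ {N M} (eq : N ≡ M) (H : Fin M → Bool) → and (tabulate H) ≡ and (tabulate (H ∘ cast eq))
and-tabulate-cast refl H = cong and (tabulate-cong λ i → cong H (sym (cast-is-id refl i)))

module _ {A : Set} where

  inject++ˡ : ∀ (xs : List A) {ys} → Fin (length xs) → Fin (length (xs ++ ys))
  inject++ˡ (x ∷ xs) zero    = zero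
  inject++ˡ (x ∷ xs) (suc i) = suc (inject++ˡ xs i)

  inject++ʳ : ∀ (xs : List A) {ys} → Fin (length ys) → Fin (length (xs ++ ys))
  inject++ʳ []       j = j
  inject++ʳ (x ∷ xs) j = suc (inject++ʳ xs j)

  split++ : ∀ (xs : List A) {ys} → Fin (length (xs ++ ys)) → Fin (length xs) ⊎ Fin (length ys)
  split++ []       e       = inj₂ e
  split++ (x ∷ xs) zero    = inj₁ zero
  split++ (x ∷ xs) (suc e) = Sum.map₁ suc (split++ xs e)

  split++-inject++ˡ : ∀ xs {ys} i → split++ xs {ys} (inject++ˡ xs i) ≡ inj₁ i
  split++-inject++ˡ (x ∷ xs) zero    = refl
  split++-inject++ˡ (x ∷ xs) (suc i) = cong (Sum.map₁ suc) (split++-inject++ˡ xs i)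

  split++-inject++ʳ : ∀ xs {ys} j → split++ xs {ys} (inject++ʳ xs j) ≡ inj₂ j
  split++-inject++ʳ []       j = refl
  split++-inject++ʳ (x ∷ xs) j = cong (Sum.map₁ suc) (split++-inject++ʳ xs j)

  and-++ : ∀ xs {ys} (H : Fin (length (xs ++ ys)) → A → Bool) →
    and (tabulate λ e → H e (lookup (xs ++ ys) e))
      ≡ and (tabulate λ i → H (inject++ˡ xs i) (lookup xs i))
        ∧ and (tabulate λ j → H (inject++ʳ xs j) (lookup ys j))
  and-++ []       H = refl
  and-++ (x ∷ xs) H = trans (cong (H zero x ∧_) (and-++ xs (H ∘ suc))) (sym (∧-assoc (H zero x) _ _))

  and-replicate : ∀ l (b : A) (H : Fin (length (replicate l b)) → A → Bool) →
    and (tabulate λ e → H e (lookup (replicate l b) e))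
      ≡ and (tabulate λ j → H (cast (sym (length-replicate l)) j) b)
  and-replicate l b H = trans (and-tabulate-cast (sym (length-replicate l)) λ e → H e (lookup (replicate l b) e))
                              (cong and (tabulate-cong λ j → cong (H _) (lookup-replicate l b j)))

  and-map-tabulate : ∀ {B : Set} {N} (f : B → A) (g : Fin N → B) (eq : N ≡ length (map f (tabulate g)))
    (H : Fin (length (map f (tabulate g))) → A → Bool) →
    and (tabulate λ e → H e (lookup (map f (tabulate g)) e)) ≡ and (tabulate λ i → H (cast eq i) (f (g i)))
  and-map-tabulate f g eq H = trans (and-tabulate-cast eq λ e → H e (lookup (map f (tabulate g)) e))
                                 (cong and (tabulate-cong λ i → cong (H _) (lookup-map-tabulate g eq i)))
    where
    lookup-map-tabulate : ∀ {N} (g : Fin N → _) .(eq : N ≡ length (map f (tabulate g))) i →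
      lookup (map f (tabulate g)) (cast eq i) ≡ f (g i)
    lookup-map-tabulate g eq zero    = refl
    lookup-map-tabulate g eq (suc i) = lookup-map-tabulate (g ∘ suc) (cong pred eq) i

-- The cycle multigraph

module _ (k l : ℕ) where

  private
    p : ℕ
    p = suc (2 * k)

    pathEdge : Fin p → Fin (suc p) × Fin (suc p)
    pathEdge i = inject₁ i , suc i

    pathEdges backEdges : List (Fin (suc p) × Fin (suc p))
    pathEdges = map pathEdge (allFin p)
    backEdges = replicate l (zero , fromℕ p)

    pathEdges-length : p ≡ length pathEdges
    pathEdges-length = sym (trans (length-map pathEdge (allFin p)) (length-tabulate id))

  pathCover : ∀ {m} → FullCover (cycleMultigraph k l) m → Fin p → Fin m ⤖ Fin m
  pathCover σ i = σ (inject++ˡ pathEdges (cast pathEdges-length i))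

  backCover : ∀ {m} → FullCover (cycleMultigraph k l) m → Fin l → Fin m ⤖ Fin m
  backCover σ j = σ (inject++ʳ pathEdges (cast (sym (length-replicate l)) j))

  isHColoring-cycle : ∀ {m} (σ : FullCover (cycleMultigraph k l) m) c →
    isHColoring (cycleMultigraph k l) m σ c
      ≡ isPathColoring p (pathCover σ) (c zero) (avoids λ j → to (backCover σ j) (c zero)) (c ∘ suc)
  isHColoring-cycle {m} σ c = begin
    isHColoring (cycleMultigraph k l) m σ c
      ≡⟨ cong and (map-tabulate id λ e → H e (lookup (pathEdges ++ backEdges) e)) ⟩
    and (tabulate λ e → H e (lookup (pathEdges ++ backEdges) e))
      ≡⟨ and-++ pathEdges H ⟩
    and (tabulate λ i → H (inject++ˡ pathEdges i) (lookup pathEdges i)) ∧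
    and (tabulate λ j → H (inject++ʳ pathEdges j) (lookup backEdges j))
      ≡⟨ cong₂ _∧_ (and-map-tabulate pathEdge id pathEdges-length (H ∘ inject++ˡ pathEdges))
                   (and-replicate l (zero , fromℕ p) (H ∘ inject++ʳ pathEdges)) ⟩
    and (tabulate λ i → not ⌊ to (pathCover σ i) (c (inject₁ i)) ≟ c (suc i) ⌋) ∧
    avoids (λ j → to (backCover σ j) (c zero)) (c (fromℕ p))
      ≡⟨ isPathColoring-tabulate p (pathCover σ) c _ ⟩
    isPathColoring p (pathCover σ) (c zero) (avoids λ j → to (backCover σ j) (c zero)) (c ∘ suc)  ∎
    where
    open ≡-Reasoning
    H : Edge (cycleMultigraph k l) → Fin (suc p) × Fin (suc p) → Bool
    H e uv = not ⌊ to (σ e) (c (proj₁ uv)) ≟ c (proj₂ uv) ⌋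

  P-DP-cover-cycle : ∀ {n} (σ : FullCover (cycleMultigraph k l) (suc n)) →
    P-DP-cover (cycleMultigraph k l) (suc n) σ
      ≡ ∑[ a < suc n ] pathCount p (pathCover σ) a (𝟙 ∘ avoids λ j → to (backCover σ j) a)
  P-DP-cover-cycle {n} σ = begin
    countFuns (suc p) (suc n) (isHColoring (cycleMultigraph k l) (suc n) σ)
      ≡⟨ countFuns-cong (suc p) (suc n) (isHColoring-cycle σ) ⟩
    countFuns (suc p) (suc n) (λ c → isPathColoring p τ (c zero) (Q (c zero)) (c ∘ suc))
      ≡⟨ countFuns-suc p (suc n) (λ c → isPathColoring p τ (c zero) (Q (c zero)) (c ∘ suc)) ⟩
    ∑[ a < suc n ] countFuns p (suc n) (isPathColoring p τ a (Q a))
      ≡⟨ sum-cong-≗ {suc n} (λ a → countFuns-isPathColoring p τ a (Q a)) ⟩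
    ∑[ a < suc n ] pathCount p τ a (𝟙 ∘ Q a)  ∎
    where
    open ≡-Reasoning
    τ = pathCover σ
    Q : Fin (suc n) → Fin (suc n) → Bool
    Q a = avoids λ j → to (backCover σ j) a

  module _ {m : ℕ} .{{_ : NonZero m}} (l<m : l < m) where

    private
      shift-bound : ∀ {l′} → l′ ≡ l → (j : Fin l′) → suc (toℕ j) < m
      shift-bound refl j = ≤-<-trans (toℕ<n j) l<m

    extremalMatching : Fin (length pathEdges) ⊎ Fin (length backEdges) → Fin m ⤖ Fin m
    extremalMatching =
      [ (λ _ → ⤖-id (Fin m)) , (λ j → rotation (suc (toℕ j)) (<⇒≤ (shift-bound (length-replicate l) j))) ]′

    extremalCover : FullCover (cycleMultigraph k l) m
    extremalCover = extremalMatching ∘ split++ pathEdges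

    pathCover-extremal : ∀ i y → to (pathCover extremalCover i) y ≡ y
    pathCover-extremal i y =
      cong (λ s → to (extremalMatching s) y) (split++-inject++ˡ pathEdges {backEdges} (cast pathEdges-length i))

    backCover-extremal : ∀ j a → to (backCover extremalCover j) a ≡ rotate (suc (toℕ j)) a
    backCover-extremal j a = trans
      (cong (λ s → to (extremalMatching s) a) (split++-inject++ʳ pathEdges (cast (sym (length-replicate l)) j)))
      (cong (λ d → rotate (suc d) a) (toℕ-cast _ j))

    backCover-extremal-injective : ∀ a → Injective _≡_ _≡_ (λ j → to (backCover extremalCover j) a)
    backCover-extremal-injective a {i} {j} eq = toℕ-injective (ℕ.suc-injective
      (rotate-injectiveˡ a (shift-bound refl i) (shift-bound refl j)
        (trans (sym (backCover-extremal i a)) (trans eq (backCover-extremal j a)))))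

    backCover-extremal-≢ : ∀ a j → to (backCover extremalCover j) a ≢ to (chain p (pathCover extremalCover)) a
    backCover-extremal-≢ a j eq = 1+n≢0 (rotate-injectiveˡ a (shift-bound refl j) (>-nonZero⁻¹ m) (begin
      rotate (suc (toℕ j)) a            ≡⟨ backCover-extremal j a ⟨
      to (backCover extremalCover j) a  ≡⟨ eq ⟩
      to (chain p τ) a                  ≡⟨ chain-id p τ pathCover-extremal a ⟩
      a                                 ≡⟨ rotate-0 a ⟨
      rotate 0 a                        ∎))
      where
      open ≡-Reasoning
      τ = pathCover extremalCover

module _ {m l T O : ℕ} (l≤m : l ≤ m) (m*O≡1+T : m * O ≡ suc T) (X : ℕ) where

  private
    m*T≡l*T+T*[m∸l] : m * T ≡ l * T + T * (m ∸ l)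
    m*T≡l*T+T*[m∸l] = begin
      m * T                ≡⟨ cong (_* T) (m+[n∸m]≡n l≤m) ⟨
      (l + (m ∸ l)) * T    ≡⟨ *-distribʳ-+ T l (m ∸ l) ⟩
      l * T + (m ∸ l) * T  ≡⟨ cong (l * T +_) (*-comm (m ∸ l) T) ⟩
      l * T + T * (m ∸ l)  ∎
      where open ≡-Reasoning

    X+m*[l*O]≡l*T+[l+X] : X + m * (l * O) ≡ l * T + (l + X)
    X+m*[l*O]≡l*T+[l+X] = begin
      X + m * (l * O)  ≡⟨ cong (X +_) (*-assoc m l O) ⟨
      X + m * l * O    ≡⟨ cong (λ t → X + t * O) (*-comm m l) ⟩
      X + l * m * O    ≡⟨ cong (X +_) (*-assoc l m O) ⟩
      X + l * (m * O)  ≡⟨ cong (λ t → X + l * t) m*O≡1+T ⟩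
      X + l * suc T    ≡⟨ cong (X +_) (*-suc l T) ⟩
      X + (l + l * T)  ≡⟨ rearrange X l (l * T) ⟩
      l * T + (l + X)  ∎
      where
      open ≡-Reasoning
      rearrange : ∀ x y z → x + (y + z) ≡ z + (y + x)
      rearrange = solve-∀

  m*T≤X+m*[l*O]⇒T*[m∸l]∸l≤X : m * T ≤ X + m * (l * O) → T * (m ∸ l) ∸ l ≤ X
  m*T≤X+m*[l*O]⇒T*[m∸l]∸l≤X le = m≤n+o⇒m∸n≤o (T * (m ∸ l)) l
    (+-cancelˡ-≤ (l * T) _ _ (subst₂ _≤_ m*T≡l*T+T*[m∸l] X+m*[l*O]≡l*T+[l+X] le))

  X+m*[l*O]≡m*T⇒X≡T*[m∸l]∸l : X + m * (l * O) ≡ m * T → X ≡ T * (m ∸ l) ∸ l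
  X+m*[l*O]≡m*T⇒X≡T*[m∸l]∸l eq = begin
    X                ≡⟨ m+n∸m≡n l X ⟨
    l + X ∸ l        ≡⟨ cong (_∸ l) (+-cancelˡ-≡ (l * T) _ _
                          (trans (sym X+m*[l*O]≡l*T+[l+X]) (trans eq m*T≡l*T+T*[m∸l]))) ⟩
    T * (m ∸ l) ∸ l  ∎
    where open ≡-Reasoning

module _ (k l r : ℕ) (l<m : l < 2 + r) where

  private
    p : ℕ
    p = suc (2 * k)

    back : FullCover (cycleMultigraph k l) (2 + r) → Fin (2 + r) → Fin l → Fin (2 + r)
    back σ a j = to (backCover k l σ j) a

    colourCount : FullCover (cycleMultigraph k l) (2 + r) → Fin (2 + r) → ℕ
    colourCount σ a = pathCount p (pathCover k l σ) a (𝟙 ∘ avoids (back σ a))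

    σ₀ : FullCover (cycleMultigraph k l) (2 + r)
    σ₀ = extremalCover k l l<m

  P-DP-cover-cycle-≥ : ∀ σ → suc r ^ p * (2 + r ∸ l) ∸ l ≤ P-DP-cover (cycleMultigraph k l) (2 + r) σ
  P-DP-cover-cycle-≥ σ = subst (suc r ^ p * (2 + r ∸ l) ∸ l ≤_) (sym (P-DP-cover-cycle k l σ))
    (m*T≤X+m*[l*O]⇒T*[m∸l]∸l≤X (<⇒≤ l<m) ([2+r]*off≡1+[1+r]^p r k) _ (begin
      (2 + r) * suc r ^ p
        ≡⟨ sum-const (2 + r) (suc r ^ p) ⟨
      ∑[ a < 2 + r ] (suc r ^ p)
        ≤⟨ sum-mono-≤ {2 + r} (λ a → pathCount-avoids-≥ r k (pathCover k l σ) a (back σ a)) ⟩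
      ∑[ a < 2 + r ] (colourCount σ a + l * off r p)
        ≡⟨ sum-+-const (colourCount σ) (l * off r p) ⟩
      sum (colourCount σ) + (2 + r) * (l * off r p)  ∎))
    where open ℕ.≤-Reasoning

  P-DP-cover-extremal : P-DP-cover (cycleMultigraph k l) (2 + r) σ₀ ≡ suc r ^ p * (2 + r ∸ l) ∸ l
  P-DP-cover-extremal = trans (P-DP-cover-cycle k l σ₀)
    (X+m*[l*O]≡m*T⇒X≡T*[m∸l]∸l (<⇒≤ l<m) ([2+r]*off≡1+[1+r]^p r k) _ (begin
      sum (colourCount σ₀) + (2 + r) * (l * off r p)
        ≡⟨ sum-+-const (colourCount σ₀) (l * off r p) ⟨
      ∑[ a < 2 + r ] (colourCount σ₀ a + l * off r p)
        ≡⟨ sum-cong-≗ {2 + r} (λ a → pathCount-avoids-≡ r k (pathCover k l σ₀) a (back σ₀ a)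
                                       (backCover-extremal-injective k l l<m a)
                                       (backCover-extremal-≢ k l l<m a)) ⟩
      ∑[ a < 2 + r ] (suc r ^ p)
        ≡⟨ sum-const (2 + r) (suc r ^ p) ⟩
      (2 + r) * suc r ^ p  ∎))
    where open ≡-Reasoning

P-DP-cycle : ∀ k l m → 2 ≤ m → l < m →
  P-DP-is (cycleMultigraph k l) m ((m ∸ 1) ^ suc (2 * k) * (m ∸ l) ∸ l)
P-DP-cycle k l (suc zero)    (s≤s ()) _
P-DP-cycle k l (suc (suc r)) _        l<m =
  (extremalCover k l l<m , P-DP-cover-extremal k l r l<m) , P-DP-cover-cycle-≥ k l r l<m

proposition15 : (k l m : ℕ) → 1 ≤ k → 1 ≤ l → l + 1 ≤ m →
    P-DP-is (cycleMultigraph k l) m (((m ∸ 1) ^ (2 * k + 1)) * (m ∸ l) ∸ l)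
proposition15 k l m _ 1≤l l+1≤m rewrite +-comm (2 * k) 1 = P-DP-cycle k l m (≤-trans (s≤s 1≤l) l<m) l<m
  where
  l<m : l < m
  l<m = subst (_≤ m) (+-comm l 1) l+1≤m
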